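{- Let $G$ be a finite simple graph. (1) If there is a constant $\lambda$ such that $d_u d_v (d_u + d_v)^2 = \lambda$ for every edge $uv\in E(G)$, then each connected component of $G$ is either regular or biregular. (2) If $G$ is connected, then there is a constant $\lambda$ such that $d_u d_v (d_u + d_v)^2 = \lambda$ for every edge $uv\in E(G)$ if and only if $G$ is either regular or biregular.
   Context: For a vertex $u$, $d_u$ denotes its degree. A graph is biregular (more precisely $(\alpha,\beta)$-biregular) if it is bipartite and, for some bipartition, every vertex in one side has degree $\alpha$ and every vertex in the other side has degree $\beta$. -}

module Defs where

open import Data.Nat using (ℕ; _+_; _*_; _^_)
open import Data.Bool using (Bool; true; false; if_then_else_)
open import Data.Fin using (Fin)
open import Data.List using (List; map; allFin)
open import Data.Nat.ListAction using (sum)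
open import Data.Product using (Σ; ∃; _×_)
open import Relation.Binary.PropositionalEquality using (_≡_; _≢_)

record SimpleGraph (n : ℕ) : Set where
  field
    adj     : Fin n → Fin n → Bool
    symm    : ∀ u v → adj u v ≡ adj v u
    loopless : ∀ v → adj v v ≡ false
open SimpleGraph public

module _ {n : ℕ} (G : SimpleGraph n) where

  deg : Fin n → ℕ
  deg u = sum (map (λ v → if adj G u v then 1 else 0) (allFin n))

  Edge : Fin n → Fin n → Set
  Edge u v = adj G u v ≡ true

  data Reach : Fin n → Fin n → Set where
    here  : ∀ {u} → Reach u u
    there : ∀ {u v w} → Edge u v → Reach v w → Reach u w

  Connected : Set
  Connected = ∀ u v → Reach u v

  ConstantIndex : Set
  ConstantIndex = ∃ λ c → ∀ u v → Edge u v →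
    deg u * deg v * (deg u + deg v) ^ 2 ≡ c

  Regular : Set
  Regular = ∃ λ k → ∀ u → deg u ≡ k

  Biregular : Set
  Biregular = Σ (Fin n → Bool) λ side → ∃ λ α → ∃ λ β →
    (∀ u v → Edge u v → side u ≢ side v) ×
    (∀ u → side u ≡ true → deg u ≡ α) ×
    (∀ u → side u ≡ false → deg u ≡ β)

  -- The connected component of x (vertices reachable from x) is regular.
  -- (Degrees in a component coincide with degrees in G.)
  ComponentRegular : Fin n → Set
  ComponentRegular x = ∃ λ k → ∀ u → Reach x u → deg u ≡ k

  ComponentBiregular : Fin n → Set
  ComponentBiregular x = Σ (Fin n → Bool) λ side → ∃ λ α → ∃ λ β →
    (∀ u v → Reach x u → Edge u v → side u ≢ side v) ×
    (∀ u → Reach x u → side u ≡ true → deg u ≡ α) ×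
    (∀ u → Reach x u → side u ≡ false → deg u ≡ β)

-- Since a b (a + b)² is strictly increasing in b for a ≥ 1, a constant index λ
-- forces the degree of one end of an edge to determine the degree of the other.
-- Fixing an edge xy, walking from x therefore alternates between the degrees
-- d_x and d_y: the component of x is regular if d_x = d_y and biregular, with
-- sides {d = d_x} and {d = d_y}, otherwise. Conversely, on a regular or
-- biregular graph every edge has the same pair of end degrees.
module Submission where

open import Defs
open import Data.Nat using (ℕ; zero; suc; _+_; _*_; _^_; _≤_; _<_; _≡ᵇ_; NonZero; >-nonZero)
open import Data.Nat.Properties
open import Data.Nat.ListAction using (sum)
open import Data.Bool using (Bool; true; false; T; if_then_else_)
open import Data.Bool.Properties using () renaming (_≟_ to _≟ᵇ_)
open import Data.Fin using (Fin)
import Data.Fin as Fin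
open import Data.Fin.Properties using (any?)
open import Data.List using (List; _∷_; map)
open import Data.List.Membership.Propositional using (_∈_)
open import Data.List.Membership.Propositional.Properties using (∈-allFin)
open import Data.List.Relation.Unary.Any using (here; there)
open import Data.Product using (_×_; _,_)
open import Data.Sum using (_⊎_; inj₁; inj₂)
open import Relation.Nullary using (yes; no; ¬_; contradiction)
open import Relation.Binary using (tri<; tri≈; tri>)
open import Relation.Binary.PropositionalEquality
open import Function.Bundles using (_⇔_; mk⇔)

index : ℕ → ℕ → ℕ
index a b = a * b * (a + b) ^ 2

index-comm : ∀ a b → index a b ≡ index b a
index-comm a b rewrite *-comm a b | +-comm a b = refl

index-monoʳ-< : ∀ a .{{_ : NonZero a}} {b c} → b < c → index a b < index a c
index-monoʳ-< a b<c = *-mono-< (*-monoʳ-< a b<c) (^-monoˡ-< 2 (+-monoʳ-< a b<c))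

index-cancelˡ-≡ : ∀ a .{{_ : NonZero a}} {b c} → index a b ≡ index a c → b ≡ c
index-cancelˡ-≡ a {b} {c} eq with <-cmp b c
... | tri< b<c _ _ = contradiction eq (<⇒≢ (index-monoʳ-< a b<c))
... | tri≈ _ b≡c _ = b≡c
... | tri> _ _ c<b = contradiction (sym eq) (<⇒≢ (index-monoʳ-< a c<b))

sum-map-≥ : ∀ {A : Set} (f : A → ℕ) {xs : List A} {x} → x ∈ xs → f x ≤ sum (map f xs)
sum-map-≥ f {y ∷ ys} (here refl) = m≤m+n (f y) _
sum-map-≥ f {y ∷ ys} (there x∈ys) = ≤-trans (sum-map-≥ f x∈ys) (m≤n+m _ (f y))

module _ {n : ℕ} (G : SimpleGraph n) where

  Edge-sym : ∀ {u v} → Edge G u v → Edge G v u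
  Edge-sym {u} {v} e = trans (symm G v u) e

  Reach-snoc : ∀ {u v w} → Reach G u v → Edge G v w → Reach G u w
  Reach-snoc here e = there e here
  Reach-snoc (there e′ r) e = there e′ (Reach-snoc r e)

  Reach-isolated : ∀ {x u} → (∀ v → ¬ Edge G x v) → Reach G x u → u ≡ x
  Reach-isolated isolated here = refl
  Reach-isolated isolated (there e _) = contradiction e (isolated _)

  deg-nonZero : ∀ {u v} → Edge G u v → NonZero (deg G u)
  deg-nonZero {u} {v} e = >-nonZero (subst (_≤ deg G u) (cong (λ b → if b then 1 else 0) e)
    (sum-map-≥ (λ w → if adj G u w then 1 else 0) (∈-allFin v)))

  Connected⇒Regular : Connected G → ∀ x → ComponentRegular G x → Regular G
  Connected⇒Regular conn x (k , reg) = k , λ u → reg u (conn x u)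

  Connected⇒Biregular : Connected G → ∀ x → ComponentBiregular G x → Biregular G
  Connected⇒Biregular conn x (side , α , β , bip , sideᵗ , sideᶠ) =
    side , α , β , (λ u v → bip u v (conn x u)) ,
    (λ u → sideᵗ u (conn x u)) , (λ u → sideᶠ u (conn x u))

  module ConstantIndexed (c : ℕ)
      (constant : ∀ u v → Edge G u v → deg G u * deg G v * (deg G u + deg G v) ^ 2 ≡ c) where

    deg-neighbour : ∀ {u u′ v v′} → deg G u ≡ deg G u′ → Edge G u v → Edge G u′ v′ →
                    deg G v ≡ deg G v′
    deg-neighbour {u} {u′} {v} {v′} du e e′ =
      index-cancelˡ-≡ (deg G u) {{deg-nonZero e}} (begin
        index (deg G u) (deg G v)   ≡⟨ constant u v e ⟩
        c                           ≡⟨ constant u′ v′ e′ ⟨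
        index (deg G u′) (deg G v′) ≡⟨ cong (λ d → index d (deg G v′)) du ⟨
        index (deg G u) (deg G v′)  ∎)
      where open ≡-Reasoning

    deg-two-valued : ∀ {x y w} → Edge G x y → Reach G x w → deg G w ≡ deg G x ⊎ deg G w ≡ deg G y
    deg-two-valued e₀ here = inj₁ refl
    deg-two-valued e₀ (there e r) with deg-two-valued (Edge-sym e) r
    ... | inj₁ dw≡dv = inj₂ (trans dw≡dv (deg-neighbour refl e e₀))
    ... | inj₂ dw≡dx = inj₁ dw≡dx

    component-regular-or-biregular : ∀ x → ComponentRegular G x ⊎ ComponentBiregular G x
    component-regular-or-biregular x with any? (λ v → adj G x v ≟ᵇ true)
    ... | no isolated = inj₁ (deg G x , λ u r → cong (deg G) (Reach-isolated (λ v e → isolated (v , e)) r))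
    ... | yes (y , e₀) with deg G x ≟ deg G y
    ...   | yes dx≡dy = inj₁ (deg G x , regular)
      where
      regular : ∀ u → Reach G x u → deg G u ≡ deg G x
      regular u r with deg-two-valued e₀ r
      ... | inj₁ du≡dx = du≡dx
      ... | inj₂ du≡dy = trans du≡dy (sym dx≡dy)
    ...   | no dx≢dy = inj₂ (side , deg G x , deg G y , bipartite , sideᵗ , sideᶠ)
      where
      side : Fin n → Bool
      side u = deg G u ≡ᵇ deg G x

      sideᵗ : ∀ u → Reach G x u → side u ≡ true → deg G u ≡ deg G x
      sideᵗ u _ s = ≡ᵇ⇒≡ (deg G u) (deg G x) (subst T (sym s) _)

      sideᶠ : ∀ u → Reach G x u → side u ≡ false → deg G u ≡ deg G y
      sideᶠ u r s with deg-two-valued e₀ r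
      ... | inj₁ du≡dx = contradiction (≡⇒≡ᵇ (deg G u) (deg G x) du≡dx) (subst T s)
      ... | inj₂ du≡dy = du≡dy

      bipartite : ∀ u v → Reach G x u → Edge G u v → side u ≢ side v
      bipartite u v r e same with side u in su
      ... | true  = dx≢dy (trans (sym (sideᵗ v (Reach-snoc r e) (sym same)))
                                 (deg-neighbour (sideᵗ u r su) e e₀))
      ... | false = dx≢dy (trans (sym (deg-neighbour (sideᶠ v (Reach-snoc r e) (sym same))
                                                     (Edge-sym e) (Edge-sym e₀)))
                                 (sideᶠ u r su))

  ConstantIndex⇒components : ConstantIndex G → ∀ x → ComponentRegular G x ⊎ ComponentBiregular G x
  ConstantIndex⇒components (c , constant) = ConstantIndexed.component-regular-or-biregular c constant

  regular-or-biregular⇒ConstantIndex : Regular G ⊎ Biregular G → ConstantIndex G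
  regular-or-biregular⇒ConstantIndex (inj₁ (k , reg)) = index k k , λ u v _ → cong₂ index (reg u) (reg v)
  regular-or-biregular⇒ConstantIndex (inj₂ (side , α , β , bip , sideᵗ , sideᶠ)) =
    index α β , λ u v e → edge-index u v (bip u v e)
    where
    edge-index : ∀ u v → side u ≢ side v → index (deg G u) (deg G v) ≡ index α β
    edge-index u v su≢sv with side u in su | side v in sv
    ... | true  | true  = contradiction refl su≢sv
    ... | false | false = contradiction refl su≢sv
    ... | true  | false = cong₂ index (sideᵗ u su) (sideᶠ v sv)
    ... | false | true  = trans (cong₂ index (sideᶠ u su) (sideᵗ v sv)) (index-comm β α)

Connected⇒regular-or-biregular : ∀ {n} (G : SimpleGraph n) → Connected G → ConstantIndex G →
                                  Regular G ⊎ Biregular G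
Connected⇒regular-or-biregular {zero}  G conn ci = inj₁ (0 , λ ())
Connected⇒regular-or-biregular {suc _} G conn ci with ConstantIndex⇒components G ci Fin.zero
... | inj₁ reg   = inj₁ (Connected⇒Regular G conn Fin.zero reg)
... | inj₂ bireg = inj₂ (Connected⇒Biregular G conn Fin.zero bireg)

mainTheorem13 : ∀ {n : ℕ} (G : SimpleGraph n) →
    (ConstantIndex G → ∀ (x : Fin n) → ComponentRegular G x ⊎ ComponentBiregular G x)
    × (Connected G → (ConstantIndex G ⇔ (Regular G ⊎ Biregular G)))
mainTheorem13 G =
  ConstantIndex⇒components G ,
  λ conn → mk⇔ (Connected⇒regular-or-biregular G conn) (regular-or-biregular⇒ConstantIndex G)
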